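{- For every numerical set $S$, the partition $\lambda=\phi(S)$ satisfies $Hk(\lambda)=(\mathbb{N}\cup\{0\})\setminus A(S)$. In particular, for every positive integer $k$, $\phi(S)$ is a $k$-core if and only if $k\in A(S)$.
   Context: A numerical set is a subset $S\subseteq\mathbb{N}\cup\{0\}$ with $0\in S$ and finite complement. Its atom monoid is $A(S)=\{n\in\mathbb{N}\cup\{0\}: n+s\in S \text{ for all } s\in S\}$. If $S\neq\mathbb{N}\cup\{0\}$, let $f$ be the largest element of $(\mathbb{N}\cup\{0\})\setminus S$ (the Frobenius number). Define $\phi(S)$ to be the partition whose profile (the outer boundary lattice path of the Young diagram, traversed from the bottom-left corner to the top-right corner, consisting of east and north unit steps) has steps numbered $0,1,\dots,f$, where step $i$ is an east step if $i\in S$ and a north step if $i\notin S$; equivalently, $\phi(S)$ is the partition whose parts are the numbers $|\{s\in S: s<g\}|$ for $g$ ranging over $(\mathbb{N}\cup\{0\})\setminus S$. If $S=\mathbb{N}\cup\{0\}$, $\phi(S)$ is the empty partition. For a partition $\lambda=(\lambda_1\ge\dots\ge\lambda_\ell\ge1)$, the hook length of cell $(i,j)$ is $h_{ij}=\lambda_i-j+\lambda'_j-i+1$ with $\lambda'_j=|\{a:\lambda_a\ge j\}|$; $Hk(\lambda)$ is the set of all hook lengths; and $\lambda$ is a $k$-core if no element of $Hk(\lambda)$ is a multiple of $k$. -}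

module Defs where

open import Data.Nat using (ℕ; zero; suc; _+_; _∸_; _≤_; _≤ᵇ_)
open import Data.Nat.Divisibility using (_∣_)
open import Data.Bool using (Bool; true; false; if_then_else_)
open import Data.List using (List; []; _∷_; length)
open import Data.Product using (Σ; ∃; _×_; _,_)
open import Relation.Binary.PropositionalEquality using (_≡_)
open import Relation.Nullary using (¬_)

record NumericalSet : Set where
  field
    mem      : ℕ → Bool
    zero∈    : mem 0 ≡ true
    bound    : ℕ
    cofinite : ∀ n → bound ≤ n → mem n ≡ true
open NumericalSet public

_∈S_ : ℕ → NumericalSet → Set
n ∈S S = mem S n ≡ true

_∈A_ : ℕ → NumericalSet → Set
n ∈A S = ∀ s → s ∈S S → (n + s) ∈S S

countBelow : (ℕ → Bool) → ℕ → ℕ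
countBelow P zero    = 0
countBelow P (suc g) = countBelow P g + (if P g then 1 else 0)

-- parts |{ s ∈ S : s < g }| for the gaps g < n, listed from the largest gap
-- down (hence weakly decreasing)
gapParts : (ℕ → Bool) → ℕ → List ℕ
gapParts P zero    = []
gapParts P (suc n) with P n
... | true  = gapParts P n
... | false = countBelow P n ∷ gapParts P n

-- φ(S): the partition whose parts are |{s ∈ S : s < g}| for g ∉ S.
-- (Every gap is < bound S, so this lists all gaps; empty when S = ℕ.)
φ : NumericalSet → List ℕ
φ S = gapParts (mem S) (bound S)

-- Partitions as weakly decreasing lists of positive parts.
-- λ_i, 1-indexed (0 outside the range 1..ℓ)
part : List ℕ → ℕ → ℕ
part []       _             = 0
part (x ∷ xs) zero          = 0
part (x ∷ xs) (suc zero)    = x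
part (x ∷ xs) (suc (suc i)) = part xs (suc i)

conj : List ℕ → ℕ → ℕ
conj []       j = 0
conj (x ∷ xs) j = (if j ≤ᵇ x then 1 else 0) + conj xs j

hook : List ℕ → ℕ → ℕ → ℕ
hook λ' i j = ((part λ' i ∸ j) + (conj λ' j ∸ i)) + 1

_∈Hk_ : ℕ → List ℕ → Set
h ∈Hk λ' = Σ ℕ λ i → Σ ℕ λ j →
  (1 ≤ i) × (i ≤ length λ') × (1 ≤ j) × (j ≤ part λ' i) × (h ≡ hook λ' i j)

IsCore : ℕ → List ℕ → Set
IsCore k λ' = ∀ h → h ∈Hk λ' → ¬ (k ∣ h)

-- Write c(n) = |S ∩ [0,n)| and d(n) = |[0,n) ∖ S|, so c(n) + d(n) = n.
-- The profile of φ(S) gives a dictionary between cells and pairs: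
--   * row i of φ(S) is the i-th largest gap g, i.e. d(g) + i = d(B) for
--     the bound B of S, and its length is c(g);
--   * column j ≥ 1 belongs to the element s ∈ S with c(s) + 1 = j, and
--     its height λ'_j is the number of gaps above s, d(B) − d(s+1).
-- Hence the cell (row of g, column of s) exists exactly when s < g, and
-- its hook length is (c(g) − c(s) − 1) + (d(g) − d(s+1)) + 1 = g − s.
-- So Hk(φ(S)) = { g − s : s ∈ S, g ∉ S, s < g }, which is the set of h
-- for which some s ∈ S has h + s ∉ S, i.e. the complement of A(S).
-- The k-core statement follows because A(S) is closed under addition.
module Submission where

open import Defs
open import Data.Nat using (ℕ; zero; suc; _+_; _*_; _∸_; _≤_; _<_; _≤ᵇ_; _<?_; z≤n; s≤s)
open import Data.Nat.Properties
open import Data.Nat.Divisibility using (divides; ∣-refl)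
open import Data.Bool using (Bool; true; false; if_then_else_)
open import Data.Bool.Properties using (T-≡; ¬-not) renaming (_≟_ to _≟ᵇ_)
open import Data.Fin using (Fin; toℕ; fromℕ<)
open import Data.Fin.Properties using (¬∀⟶∃¬; toℕ-fromℕ<)
open import Data.List using (length)
open import Data.Product using (_×_; Σ; _,_)
open import Data.Sum using (inj₁; inj₂)
open import Data.Empty using (⊥-elim)
open import Function.Bundles using (_⇔_; mk⇔; Equivalence)
open import Relation.Nullary using (¬_; Dec; yes; no)
open import Relation.Nullary.Decidable using (_→-dec_)
open import Relation.Binary.PropositionalEquality
open import Algebra.Properties.CommutativeSemigroup +-commutativeSemigroup
  using (interchange)

true≢false : true ≢ false
true≢false ()

stepwise-monotone : (f : ℕ → ℕ) → (∀ n → f n ≤ f (suc n)) →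
  ∀ {m n} → m ≤ n → f m ≤ f n
stepwise-monotone f step {n = zero} z≤n = ≤-refl
stepwise-monotone f step {n = suc n} m≤1+n with m≤n⇒m<n∨m≡n m≤1+n
... | inj₂ refl = ≤-refl
... | inj₁ (s≤s m≤n) = ≤-trans (stepwise-monotone f step m≤n) (step n)

≤ᵇ-true : ∀ {j x} → j ≤ x → (j ≤ᵇ x) ≡ true
≤ᵇ-true j≤x = Equivalence.to T-≡ (≤⇒≤ᵇ j≤x)

≤ᵇ-false : ∀ {j x} → x < j → (j ≤ᵇ x) ≡ false
≤ᵇ-false {j} {x} x<j =
  ¬-not (λ e → <⇒≱ x<j (≤ᵇ⇒≤ j x (Equivalence.from T-≡ e)))

module Profile (P : ℕ → Bool) where

  elemsBelow : ℕ → ℕ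
  elemsBelow = countBelow P

  gapsBelow : ℕ → ℕ
  gapsBelow zero    = 0
  gapsBelow (suc n) = gapsBelow n + (if P n then 0 else 1)

  elems+gaps : ∀ n → elemsBelow n + gapsBelow n ≡ n
  elems+gaps zero = refl
  elems+gaps (suc n) with P n
  ... | true  = trans (cong₂ _+_ (+-comm (elemsBelow n) 1) (+-identityʳ (gapsBelow n)))
                      (cong suc (elems+gaps n))
  ... | false = trans (cong₂ _+_ (+-identityʳ (elemsBelow n)) (+-comm (gapsBelow n) 1))
                      (trans (+-suc (elemsBelow n) (gapsBelow n)) (cong suc (elems+gaps n)))

  elemsBelow-mono : ∀ {m n} → m ≤ n → elemsBelow m ≤ elemsBelow n
  elemsBelow-mono = stepwise-monotone elemsBelow (λ n → m≤m+n (elemsBelow n) _)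

  gapsBelow-mono : ∀ {m n} → m ≤ n → gapsBelow m ≤ gapsBelow n
  gapsBelow-mono = stepwise-monotone gapsBelow (λ n → m≤m+n (gapsBelow n) _)

  elemsBelow-elem : ∀ s → P s ≡ true → elemsBelow (suc s) ≡ suc (elemsBelow s)
  elemsBelow-elem s ps rewrite ps = +-comm (elemsBelow s) 1

  length-gapParts : ∀ n → length (gapParts P n) ≡ gapsBelow n
  length-gapParts zero = refl
  length-gapParts (suc n) with P n
  ... | true  = trans (length-gapParts n) (sym (+-identityʳ _))
  ... | false = trans (cong suc (length-gapParts n)) (+-comm 1 (gapsBelow n))

  -- Row i of gapParts P n comes from the gap g: exactly i − 1 gaps below n
  -- lie above g, and the row has length c(g).
  RowOf : ℕ → ℕ → ℕ → Set
  RowOf n i g = gapsBelow g + i ≡ gapsBelow n × part (gapParts P n) i ≡ elemsBelow g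

  -- Passing from n to n + 1 with n a gap prepends a row, shifting the others.
  shift-row : ∀ n i g → gapsBelow g + suc i ≡ gapsBelow n →
    gapsBelow g + suc (suc i) ≡ gapsBelow n + 1
  shift-row n i g e =
    trans (+-suc (gapsBelow g) (suc i)) (trans (cong suc e) (+-comm 1 (gapsBelow n)))

  row-gap : ∀ n i → 1 ≤ i → i ≤ length (gapParts P n) →
    Σ ℕ λ g → g < n × P g ≡ false × RowOf n i g
  row-gap zero i 1≤i i≤0 = ⊥-elim (<⇒≱ 1≤i i≤0)
  row-gap (suc n) i 1≤i i≤len with P n in pn
  ... | true with row-gap n i 1≤i i≤len
  ...   | g , g<n , pg , e , row = g , m<n⇒m<1+n g<n , pg , trans e (sym (+-identityʳ _)) , row
  row-gap (suc n) (suc zero) 1≤i i≤len | false = n , ≤-refl , pn , refl , refl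
  row-gap (suc n) (suc (suc i)) 1≤i (s≤s i≤len) | false with row-gap n (suc i) (s≤s z≤n) i≤len
  ... | g , g<n , pg , e , row = g , m<n⇒m<1+n g<n , pg , shift-row n i g e , row

  gap-row : ∀ n g → g < n → P g ≡ false → Σ ℕ λ i → 1 ≤ i × RowOf n i g
  gap-row (suc n) g g<1+n pg with P n in pn | m≤n⇒m<n∨m≡n (≤-pred g<1+n)
  ... | true | inj₂ refl = ⊥-elim (true≢false (trans (sym pn) pg))
  ... | true | inj₁ g<n with gap-row n g g<n pg
  ...   | i , 1≤i , e , row = i , 1≤i , trans e (sym (+-identityʳ _)) , row
  gap-row (suc n) g g<1+n pg | false | inj₂ refl = 1 , s≤s z≤n , refl , refl
  gap-row (suc n) g g<1+n pg | false | inj₁ g<n with gap-row n g g<n pg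
  ... | suc i , _ , e , row = suc (suc i) , s≤s z≤n , shift-row n i g e , row

  column-elem : ∀ g j → 1 ≤ j → j ≤ elemsBelow g →
    Σ ℕ λ s → s < g × P s ≡ true × j ≡ suc (elemsBelow s)
  column-elem zero j 1≤j j≤0 = ⊥-elim (<⇒≱ 1≤j j≤0)
  column-elem (suc g) j 1≤j j≤c with P g in pg
  ... | false with column-elem g j 1≤j (subst (j ≤_) (+-identityʳ _) j≤c)
  ...   | s , s<g , ps , e = s , m<n⇒m<1+n s<g , ps , e
  column-elem (suc g) j 1≤j j≤c | true
    with m≤n⇒m<n∨m≡n (subst (j ≤_) (+-comm (elemsBelow g) 1) j≤c)
  ... | inj₂ e = g , ≤-refl , pg , e
  ... | inj₁ (s≤s j≤c′) with column-elem g j 1≤j j≤c′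
  ...   | s , s<g , ps , e = s , m<n⇒m<1+n s<g , ps , e

  tallGaps : ℕ → ℕ → ℕ
  tallGaps j zero    = 0
  tallGaps j (suc n) = tallGaps j n + (if P n then 0 else (if j ≤ᵇ elemsBelow n then 1 else 0))

  conj-gapParts : ∀ n j → conj (gapParts P n) j ≡ tallGaps j n
  conj-gapParts zero j = refl
  conj-gapParts (suc n) j with P n
  ... | true  = trans (conj-gapParts n j) (sym (+-identityʳ _))
  ... | false = trans (+-comm (if j ≤ᵇ elemsBelow n then 1 else 0) (conj (gapParts P n) j))
                      (cong (_+ (if j ≤ᵇ elemsBelow n then 1 else 0)) (conj-gapParts n j))

  -- For the column j = c(s) + 1 of an element s, the tall gaps are exactly
  -- the gaps above s: there are none below s + 1, and d(n) − d(s+1) below n.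
  module Column (s : ℕ) (ps : P s ≡ true) where

    j : ℕ
    j = suc (elemsBelow s)

    no-tall-gaps : ∀ n → n ≤ suc s → tallGaps j n ≡ 0
    no-tall-gaps zero _ = refl
    no-tall-gaps (suc n) (s≤s n≤s) with P n
    ... | true = trans (+-identityʳ _) (no-tall-gaps n (m≤n⇒m≤1+n n≤s))
    ... | false rewrite ≤ᵇ-false (s≤s (elemsBelow-mono n≤s))
          = trans (+-identityʳ _) (no-tall-gaps n (m≤n⇒m≤1+n n≤s))

    tall-gaps : ∀ n → suc s ≤ n → tallGaps j n + gapsBelow (suc s) ≡ gapsBelow n
    tall-gaps (suc n) (s≤s s≤n) with m≤n⇒m<n∨m≡n s≤n
    ... | inj₂ refl rewrite no-tall-gaps (suc s) ≤-refl = refl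
    ... | inj₁ s<n with P n
    ...   | true = trans (cong (_+ gapsBelow (suc s)) (+-identityʳ (tallGaps j n)))
                         (trans (tall-gaps n s<n) (sym (+-identityʳ _)))
    ...   | false rewrite ≤ᵇ-true (subst (_≤ elemsBelow n) (elemsBelow-elem s ps) (elemsBelow-mono s<n))
          = begin
            tallGaps j n + 1 + gapsBelow (suc s)   ≡⟨ +-assoc (tallGaps j n) 1 _ ⟩
            tallGaps j n + (1 + gapsBelow (suc s)) ≡⟨ cong (tallGaps j n +_) (+-comm 1 _) ⟩
            tallGaps j n + (gapsBelow (suc s) + 1) ≡⟨ +-assoc (tallGaps j n) _ 1 ⟨
            tallGaps j n + gapsBelow (suc s) + 1   ≡⟨ cong (_+ 1) (tall-gaps n s<n) ⟩
            gapsBelow n + 1 ∎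
      where open ≡-Reasoning

  hook-cell : ∀ n g s i → P s ≡ true → s < g → g < n → RowOf n i g →
    hook (gapParts P n) i (suc (elemsBelow s)) + s ≡ g
  hook-cell n g s i ps s<g g<n (rowEnd , rowLength) = begin
      hook (gapParts P n) i j + s           ≡⟨ cong (_+ s) hook≡ ⟩
      arm + leg + 1 + s                     ≡⟨ +-assoc (arm + leg) 1 s ⟩
      arm + leg + suc s                     ≡⟨ cong (arm + leg +_) (elems+gaps (suc s)) ⟨
      arm + leg + (elemsBelow (suc s) + dₛ) ≡⟨ cong (λ t → arm + leg + (t + dₛ)) (elemsBelow-elem s ps) ⟩
      arm + leg + (j + dₛ)                  ≡⟨ interchange arm leg j dₛ ⟩
      (arm + j) + (leg + dₛ)                ≡⟨ cong₂ _+_ (m∸n+n≡m j≤c) (m∸n+n≡m dₛ≤d) ⟩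
      elemsBelow g + gapsBelow g            ≡⟨ elems+gaps g ⟩
      g ∎
    where
      open ≡-Reasoning
      open Column s ps
      dₛ = gapsBelow (suc s)
      j≤c : j ≤ elemsBelow g
      j≤c = subst (_≤ elemsBelow g) (elemsBelow-elem s ps) (elemsBelow-mono s<g)
      dₛ≤d : dₛ ≤ gapsBelow g
      dₛ≤d = gapsBelow-mono s<g
      arm = elemsBelow g ∸ j
      leg = gapsBelow g ∸ dₛ
      height : tallGaps j n ≡ leg + i
      height = +-cancelʳ-≡ dₛ _ _ (begin
        tallGaps j n + dₛ  ≡⟨ tall-gaps n (≤-trans s<g (<⇒≤ g<n)) ⟩
        gapsBelow n        ≡⟨ rowEnd ⟨
        gapsBelow g + i    ≡⟨ cong (_+ i) (m∸n+n≡m dₛ≤d) ⟨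
        leg + dₛ + i       ≡⟨ +-assoc leg dₛ i ⟩
        leg + (dₛ + i)     ≡⟨ cong (leg +_) (+-comm dₛ i) ⟩
        leg + (i + dₛ)     ≡⟨ +-assoc leg i dₛ ⟨
        leg + i + dₛ       ∎)
      hook≡ : hook (gapParts P n) i j ≡ arm + leg + 1
      hook≡ = begin
        hook (gapParts P n) i j ≡⟨ cong₂ (λ a b → a ∸ j + (b ∸ i) + 1) rowLength
                                     (trans (conj-gapParts n j) height) ⟩
        arm + (leg + i ∸ i) + 1 ≡⟨ cong (λ t → arm + t + 1) (m+n∸n≡m leg i) ⟩
        arm + leg + 1           ∎

module Atoms (S : NumericalSet) where

  atom-zero : 0 ∈A S
  atom-zero s s∈S = s∈S

  atom-+ : ∀ {a b} → a ∈A S → b ∈A S → (a + b) ∈A S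
  atom-+ {a} {b} aA bA s s∈S =
    subst (_∈S S) (sym (+-assoc a b s)) (aA (b + s) (bA s s∈S))

  atom-multiple : ∀ {k} → k ∈A S → ∀ q → (q * k) ∈A S
  atom-multiple kA zero    = atom-zero
  atom-multiple kA (suc q) = atom-+ kA (atom-multiple kA q)

  witness-refutes-atom : ∀ {h s} → s ∈S S → mem S (h + s) ≡ false → ¬ (h ∈A S)
  witness-refutes-atom s∈S gap hA = true≢false (trans (sym (hA _ s∈S)) gap)

  -- Conversely, a non-atom has such a witness: above the bound every
  -- number lies in S, so a finite search below the bound finds it.
  non-atom-witness : ∀ h → ¬ (h ∈A S) →
    Σ ℕ λ s → s ∈S S × mem S (h + s) ≡ false
  non-atom-witness h nA with ¬∀⟶∃¬ (bound S) Good good? (λ allGood → nA (atom allGood))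
    where
      Good : Fin (bound S) → Set
      Good i = toℕ i ∈S S → (h + toℕ i) ∈S S
      good? : ∀ i → Dec (Good i)
      good? i = (mem S (toℕ i) ≟ᵇ true) →-dec (mem S (h + toℕ i) ≟ᵇ true)
      atom : (∀ i → Good i) → h ∈A S
      atom allGood s s∈S with s <? bound S
      ... | yes s<B = subst (λ t → (h + t) ∈S S) (toℕ-fromℕ< s<B)
                        (allGood (fromℕ< s<B) (subst (_∈S S) (sym (toℕ-fromℕ< s<B)) s∈S))
      ... | no s≮B = cofinite S (h + s) (≤-trans (≮⇒≥ s≮B) (m≤n+m s h))
  ... | i , bad = toℕ i , refuted bad
    where
      refuted : ∀ {a b : Bool} → ¬ (a ≡ true → b ≡ true) → a ≡ true × b ≡ false
      refuted {true}  {false} _   = refl , refl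
      refuted {true}  {true}  bad = ⊥-elim (bad (λ _ → refl))
      refuted {false}         bad = ⊥-elim (bad (λ ()))

  gap-below-bound : ∀ {g} → mem S g ≡ false → g < bound S
  gap-below-bound {g} g∉S = ≰⇒> (λ B≤g → true≢false (trans (sym (cofinite S g B≤g)) g∉S))

module Hooks (S : NumericalSet) where
  open Profile (mem S)
  open Atoms S

  -- Every hook length h = g − s comes with s ∈ S and g ∉ S, so h ∉ A(S).
  hook-not-atom : ∀ h → h ∈Hk φ S → ¬ (h ∈A S)
  hook-not-atom h (i , j , 1≤i , i≤ℓ , 1≤j , j≤λᵢ , h≡) with row-gap (bound S) i 1≤i i≤ℓ
  ... | g , g<B , g∉S , row@(_ , rowLength) with column-elem g j 1≤j (subst (j ≤_) rowLength j≤λᵢ)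
  ... | s , s<g , s∈S , refl = witness-refutes-atom s∈S
        (subst (λ t → mem S t ≡ false)
          (sym (trans (cong (_+ s) h≡) (hook-cell (bound S) g s i s∈S s<g g<B row))) g∉S)

  -- If s ∈ S and g = h + s ∉ S, then h is the hook length of the cell in
  -- the row of g and the column of s.
  difference-hook : ∀ h s → s ∈S S → mem S (h + s) ≡ false → h ∈Hk φ S
  difference-hook h s s∈S g∉S with gap-row (bound S) (h + s) (gap-below-bound g∉S) g∉S
  ... | i , 1≤i , row@(rowEnd , rowLength) =
        i , suc (elemsBelow s) , 1≤i , i≤ℓ , s≤s z≤n , j≤λᵢ ,
        sym (+-cancelʳ-≡ s _ _ (hook-cell (bound S) (h + s) s i s∈S s<g (gap-below-bound g∉S) row))
    where
      1≤h : 1 ≤ h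
      1≤h = n≢0⇒n>0 (λ h≡0 → true≢false
              (trans (sym s∈S) (subst (λ t → mem S (t + s) ≡ false) h≡0 g∉S)))
      s<g : s < h + s
      s<g = +-monoˡ-≤ s 1≤h
      i≤ℓ : i ≤ length (φ S)
      i≤ℓ = subst (i ≤_) (trans rowEnd (sym (length-gapParts (bound S)))) (m≤n+m i _)
      j≤λᵢ : suc (elemsBelow s) ≤ part (φ S) i
      j≤λᵢ = subst₂ _≤_ (elemsBelow-elem s s∈S) (sym rowLength) (elemsBelow-mono s<g)

  non-atom-hook : ∀ h → ¬ (h ∈A S) → h ∈Hk φ S
  non-atom-hook h nA with non-atom-witness h nA
  ... | s , s∈S , g∉S = difference-hook h s s∈S g∉S

theorem4 : (S : NumericalSet) →
    ((h : ℕ) → (h ∈Hk φ S) ⇔ (¬ (h ∈A S)))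
    × ((k : ℕ) → 1 ≤ k → IsCore k (φ S) ⇔ (k ∈A S))
theorem4 S = (λ h → mk⇔ (hook-not-atom h) (non-atom-hook h))
           , (λ k _ → mk⇔ (core⇒atom k) (atom⇒core k))
  where
    open Atoms S
    open Hooks S
    -- If k ∉ A(S) then k itself is a hook length, a multiple of k.
    core⇒atom : ∀ k → IsCore k (φ S) → k ∈A S
    core⇒atom k core s s∈S with mem S (k + s) in k+s
    ... | true  = refl
    ... | false = ⊥-elim (core k (non-atom-hook k (witness-refutes-atom s∈S k+s)) ∣-refl)
    -- A hook length q·k with k ∈ A(S) would itself lie in A(S).
    atom⇒core : ∀ k → k ∈A S → IsCore k (φ S)
    atom⇒core k kA h h∈Hk (divides q h≡qk) =
      hook-not-atom h h∈Hk (subst (_∈A S) (sym h≡qk) (atom-multiple kA q))
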